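{- Let $k$ and $d$ be positive integers with $k\ne d^2$ such that $R=\dfrac{4d^2}{k-d^2}$ is an integer. Then there are positive integers $s,v,m$ such that $$d=\frac{svm}{2}\quad\text{and}\quad k=\frac{s^2v(vm^2+4\epsilon)}{4},$$ where $\epsilon=\operatorname{sgn}(k-d^2)\in\{1,-1\}$. -}

module Defs where

open import Data.Nat using (zero; suc)
open import Data.Integer using (ℤ; +_; -[1+_]; 0ℤ; 1ℤ; -1ℤ)

sgn : ℤ → ℤ
sgn (+ zero)    = 0ℤ
sgn (+ (suc _)) = 1ℤ
sgn -[1+ _ ]    = -1ℤ

-- Put e = k − d², which is nonzero, so the hypothesis says that |e| divides
-- N² with N = 2d. Every divisor e of N² has the shape e = s²v with s·v ∣ N:
-- writing g = gcd(e, N), e = t·g and N = u·g with t, u coprime, the divisibility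
-- t·g ∣ N·N = u·N·g gives t ∣ u·N, hence t ∣ N and so t ∣ g, say g = v·t; then
-- e = t²v and N = t·v·u. Finally 4k = (2d)² + 4e = (svm)² + 4ε·s²v.
module Submission where

open import Defs
open import Data.Integer using (ℤ; _+_; _-_; _*_; _<_; +_; 0ℤ)
open import Data.Product using (∃; _×_; _,_)
open import Relation.Binary.PropositionalEquality using (_≡_; _≢_)

open import Data.Integer using (-[1+_]; ∣_∣; +<+)
import Data.Integer.Properties as ℤ
open import Data.Integer.Tactic.RingSolver using (solve)
open import Data.Nat as ℕ using (ℕ; suc; NonZero; >-nonZero; >-nonZero⁻¹; ≢-nonZero; ≢-nonZero⁻¹)
import Data.Nat.Properties as ℕ
import Data.Nat.Tactic.RingSolver as ℕ
open import Data.Nat.Divisibility using (_∣_; divides; m∣m*n; *-cancelʳ-∣)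
open import Data.Nat.GCD using (gcd; GCD; module GCD; gcd-GCD; GCD-*; gcd[m,n]∣m; gcd[m,n]∣n; gcd[m,n]≢0)
open import Data.Nat.Coprimality using (Coprime; GCD≡1⇒coprime; coprime-divisor)
open import Data.List using ([]; _∷_)
open import Data.Sum using (inj₁)
open import Relation.Binary.PropositionalEquality using (refl; sym; trans; cong; cong₂; subst; subst₂; module ≡-Reasoning)

open ≡-Reasoning

SquareFactorisation : ℕ → ℕ → Set
SquareFactorisation e n = ∃ λ s → ∃ λ v → ∃ λ m → s ℕ.* s ℕ.* v ≡ e × s ℕ.* v ℕ.* m ≡ n

coprime-cofactors : ∀ {t u g} .{{_ : NonZero g}} → GCD (t ℕ.* g) (u ℕ.* g) g → Coprime t u
coprime-cofactors {g = g} g-gcd =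
  GCD≡1⇒coprime (GCD-* (subst (GCD _ _) (sym (ℕ.*-identityˡ g)) g-gcd))

cofactor∣gcd : ∀ t u g .{{_ : NonZero g}} → GCD (t ℕ.* g) (u ℕ.* g) g →
  t ℕ.* g ∣ (u ℕ.* g) ℕ.* (u ℕ.* g) → t ∣ g
cofactor∣gcd t u g g-gcd tg∣[ug]² = GCD.greatest g-gcd (m∣m*n g , t∣ug)
  where
  [ug]²-regrouped : (u ℕ.* g) ℕ.* (u ℕ.* g) ≡ (u ℕ.* (u ℕ.* g)) ℕ.* g
  [ug]²-regrouped = ℕ.solve (u ∷ g ∷ [])

  t∣ug : t ∣ u ℕ.* g
  t∣ug = coprime-divisor (coprime-cofactors {t} {u} g-gcd)
          (*-cancelʳ-∣ g (subst (t ℕ.* g ∣_) [ug]²-regrouped tg∣[ug]²))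

cofactors-squareFactorisation : ∀ t u g .{{_ : NonZero g}} → GCD (t ℕ.* g) (u ℕ.* g) g →
  t ℕ.* g ∣ (u ℕ.* g) ℕ.* (u ℕ.* g) → SquareFactorisation (t ℕ.* g) (u ℕ.* g)
cofactors-squareFactorisation t u g g-gcd tg∣[ug]² with cofactor∣gcd t u g g-gcd tg∣[ug]²
... | divides v refl = t , v , u , ℕ.solve (t ∷ v ∷ []) , ℕ.solve (t ∷ v ∷ u ∷ [])

divisor-of-square : ∀ {e n} .{{_ : NonZero e}} → e ∣ n ℕ.* n → SquareFactorisation e n
divisor-of-square {e} {n} e∣n² with gcd[m,n]∣m e n | gcd[m,n]∣n e n
... | divides t e≡tg | divides u n≡ug =
  subst₂ SquareFactorisation (sym e≡tg) (sym n≡ug)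
    (cofactors-squareFactorisation t u g
      (subst₂ (λ a b → GCD a b g) e≡tg n≡ug (gcd-GCD e n))
      (subst₂ (λ a b → a ∣ b ℕ.* b) e≡tg n≡ug e∣n²))
  where
  g = gcd e n
  instance
    g≢0 : NonZero g
    g≢0 = ≢-nonZero (gcd[m,n]≢0 e n (inj₁ (≢-nonZero⁻¹ e)))

positive-factors : ∀ a b c → 0 ℕ.< a ℕ.* b ℕ.* c → 0 ℕ.< a × 0 ℕ.< b × 0 ℕ.< c
positive-factors a b c 0<abc = >-nonZero⁻¹ a {{a≢0}} , >-nonZero⁻¹ b {{b≢0}} , >-nonZero⁻¹ c {{c≢0}}
  where
  abc≢0 : NonZero (a ℕ.* b ℕ.* c)
  abc≢0 = >-nonZero 0<abc
  ab≢0 : NonZero (a ℕ.* b)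
  ab≢0 = ℕ.m*n≢0⇒m≢0 (a ℕ.* b) {{abc≢0}}
  a≢0 : NonZero a
  a≢0 = ℕ.m*n≢0⇒m≢0 a {{ab≢0}}
  b≢0 : NonZero b
  b≢0 = ℕ.m*n≢0⇒n≢0 a {{ab≢0}}
  c≢0 : NonZero c
  c≢0 = ℕ.m*n≢0⇒n≢0 (a ℕ.* b) {{abc≢0}}

pos-*-* : ∀ a b c → + (a ℕ.* b ℕ.* c) ≡ + a * + b * + c
pos-*-* a b c = trans (ℤ.pos-* (a ℕ.* b) c) (cong (_* + c) (ℤ.pos-* a b))

sgn-*-abs : ∀ i → sgn i * + ∣ i ∣ ≡ i
sgn-*-abs (+ 0)     = refl
sgn-*-abs (+ suc n) = ℤ.*-identityˡ (+ suc n)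
sgn-*-abs -[1+ n ]  = ℤ.-1*i≡-i (+ suc n)

four-k-by-completing-square : ∀ k d s v m σ → + 2 * d ≡ s * v * m → k - d * d ≡ σ * (s * s * v) →
  + 4 * k ≡ s * s * v * (v * m * m + + 4 * σ)
four-k-by-completing-square k d s v m σ 2d≡svm e≡σs²v = begin
  + 4 * k                                             ≡⟨ solve (k ∷ d ∷ []) ⟩
  (+ 2 * d) * (+ 2 * d) + + 4 * (k - d * d)           ≡⟨ cong₂ (λ x y → x * x + + 4 * y) 2d≡svm e≡σs²v ⟩
  (s * v * m) * (s * v * m) + + 4 * (σ * (s * s * v)) ≡⟨ solve (s ∷ v ∷ m ∷ σ ∷ []) ⟩
  s * s * v * (v * m * m + + 4 * σ)                   ∎

proposition3p1 : (k d : ℤ) → 0ℤ < k → 0ℤ < d → k ≢ d * d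
    → ∃ (λ (R : ℤ) → R * (k - d * d) ≡ + 4 * (d * d))
    → ∃ λ (s : ℤ) → ∃ λ (v : ℤ) → ∃ λ (m : ℤ) →
        0ℤ < s × 0ℤ < v × 0ℤ < m
        × + 2 * d ≡ s * v * m
        × + 4 * k ≡ s * s * v * (v * m * m + + 4 * sgn (k - d * d))
proposition3p1 k d@(+ D) _ (+<+ 0<D) k≢d² (R , R*e≡4d²) =
  let s , v , m , s²v≡∣e∣ , svm≡2D = divisor-of-square {{∣e∣≢0}} ∣e∣∣[2D]²
      0<s , 0<v , 0<m = positive-factors s v m (subst (0 ℕ.<_) (sym svm≡2D) (ℕ.*-monoʳ-< 2 0<D))
      2d≡svm = trans (sym (ℤ.pos-* 2 D)) (trans (cong +_ (sym svm≡2D)) (pos-*-* s v m))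
      e≡sgn·s²v = trans (sym (sgn-*-abs e)) (cong (sgn e *_) (trans (cong +_ (sym s²v≡∣e∣)) (pos-*-* s s v)))
  in + s , + v , + m , +<+ 0<s , +<+ 0<v , +<+ 0<m , 2d≡svm ,
     four-k-by-completing-square k d (+ s) (+ v) (+ m) (sgn e) 2d≡svm e≡sgn·s²v
  where
  e = k - d * d

  ∣e∣≢0 : NonZero ∣ e ∣
  ∣e∣≢0 = ≢-nonZero λ ∣e∣≡0 → k≢d² (ℤ.i-j≡0⇒i≡j k (d * d) (ℤ.∣i∣≡0⇒i≡0 ∣e∣≡0))

  ∣e∣∣[2D]² : ∣ e ∣ ∣ (2 ℕ.* D) ℕ.* (2 ℕ.* D)
  ∣e∣∣[2D]² = divides ∣ R ∣ (begin
    ∣ + ((2 ℕ.* D) ℕ.* (2 ℕ.* D)) ∣      ≡⟨ cong ∣_∣ (ℤ.pos-* (2 ℕ.* D) (2 ℕ.* D)) ⟩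
    ∣ + (2 ℕ.* D) * + (2 ℕ.* D) ∣        ≡⟨ cong (λ x → ∣ x * x ∣) (ℤ.pos-* 2 D) ⟩
    ∣ (+ 2 * d) * (+ 2 * d) ∣            ≡⟨ cong ∣_∣ (double-squared d) ⟩
    ∣ + 4 * (d * d) ∣                    ≡⟨ cong ∣_∣ (sym R*e≡4d²) ⟩
    ∣ R * e ∣                            ≡⟨ ℤ.abs-* R e ⟩
    ∣ R ∣ ℕ.* ∣ e ∣                      ∎)
    where
    double-squared : ∀ x → (+ 2 * x) * (+ 2 * x) ≡ + 4 * (x * x)
    double-squared x = solve (x ∷ [])
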